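{- $13 \leq \chi_{\bar{2}}(9) \leq 14$. In other words, the vertices of $Q_9^2$ can be properly colored with $14$ colors, and every proper coloring of $Q_9^2$ uses at least $13$ colors.
   Context: The $n$-hypercube $Q_n$ is the graph whose vertex set is $\{0,1\}^n$, with two vertices adjacent exactly when their Hamming distance is $1$. For a graph $G$, its $k$th power $G^k$ is the graph on the same vertex set in which two distinct vertices are adjacent exactly when their distance in $G$ is at most $k$. $\chi_{\bar{k}}(n)$ denotes the chromatic number of $Q_n^k$. Equivalently, $\chi_{\bar{k}}(n)$ is the minimum number of binary codes of minimum Hamming distance at least $k+1$ into which $\{0,1\}^n$ can be partitioned. Thus $\chi_{\bar{2}}(9)$ is the minimum number of colors in a coloring of $\{0,1\}^9$ in which any two distinct strings at Hamming distance $1$ or $2$ receive different colors. -}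

module Defs where

open import Data.Nat using (ℕ; zero; suc; _+_; _≤_)
open import Data.Bool using (Bool; true; false; _≟_)
open import Data.Vec using (Vec; []; _∷_)
open import Data.Fin using (Fin)
open import Data.Product using (_×_; ∃)
open import Relation.Binary.PropositionalEquality using (_≡_; _≢_)
open import Relation.Nullary using (¬_; does)

Vertex : ℕ → Set
Vertex n = Vec Bool n

hamming : ∀ {n} → Vertex n → Vertex n → ℕ
hamming [] [] = 0
hamming (x ∷ xs) (y ∷ ys) with does (x ≟ y)
... | true  = hamming xs ys
... | false = suc (hamming xs ys)

QAdj : ∀ {n} → Vertex n → Vertex n → Set
QAdj u v = hamming u v ≡ 1

data Walk {n : ℕ} : ℕ → Vertex n → Vertex n → Set where
  here : ∀ {u} → Walk 0 u u
  step : ∀ {l u v w} → QAdj u v → Walk l v w → Walk (suc l) u w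

DistLe : ∀ {n} → ℕ → Vertex n → Vertex n → Set
DistLe {n} k u v = ∃ λ l → l ≤ k × Walk {n} l u v

PowAdj : (n k : ℕ) → Vertex n → Vertex n → Set
PowAdj n k u v = u ≢ v × DistLe k u v

ProperColoring : (n k c : ℕ) → (Vertex n → Fin c) → Set
ProperColoring n k c f = ∀ u v → PowAdj n k u v → f u ≢ f v

Colorable : (n k c : ℕ) → Set
Colorable n k c = ∃ λ (f : Vertex n → Fin c) → ProperColoring n k c f

module Submission where

-- Upper bound: an explicit colouring with 14 colours, whose properness is decided by evaluation.
-- Lower bound: a colour class C of a proper colouring of Q₉² is a binary code of minimum
-- distance 3.  With g the indicator of C, ĝ its Fourier transform and Φ = ∑_z β(|z|) χ_z for
-- weights β ≥ 0,
--   ∑_z β(|z|) ĝ(z)² = ∑_{x,y ∈ C} Φ(x ⊕ y).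
-- For Delsarte's weights the term z = 0 bounds the left side below by 6|C|², while Φ ≤ 0 on
-- words of weight at least 3 leaves only the diagonal, 256|C|, on the right.  So |C| ≤ 42,
-- and 512 ≤ 42 c gives c ≥ 13.

open import Defs
import Data.Integer.Properties as ℤ
open import Algebra.Properties.CommutativeMonoid.Sum ℤ.+-0-commutativeMonoid
  using (sum; sum-syntax; sum-replicate-zero)
open import Algebra.Properties.CommutativeSemigroup ℤ.+-commutativeSemigroup
  using (interchange)
open import Data.Bool using (Bool; true; false; not; _xor_; T)
import Data.Bool as Bool
open import Data.Bool.Properties using (xor-same)
open import Data.Fin using (Fin; #_)
import Data.Fin as Fin
open import Data.Integer using (ℤ; +_; +[1+_]; -[1+_]; -_; _+_; _*_; _≤_; 0ℤ; 1ℤ; +≤+; nonNegative)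
open import Data.Integer.Properties using (module ≤-Reasoning)
open import Data.Integer.Tactic.RingSolver using (solve-∀)
open import Data.List using (List; []; _∷_; map; _++_)
open import Data.List.Membership.Propositional using (_∈_)
open import Data.List.Membership.Propositional.Properties using (∈-map⁺; ∈-++⁺ˡ; ∈-++⁺ʳ)
open import Data.List.Relation.Unary.All as All using (All; all?)
open import Data.List.Relation.Unary.Any using (here)
open import Data.Nat as ℕ using (ℕ; zero; suc; _^_; z≤n; s≤s; z<s)
import Data.Nat.Properties as ℕ
open import Data.Product using (_,_; _×_)
open import Data.Vec using (Vec; []; _∷_; zipWith; replicate; take; drop)
open import Data.Vec.Properties using (≡-dec; ∷-injectiveʳ)
open import Function using (_∘_; _$_)
open import Relation.Binary.PropositionalEquality
open import Relation.Nullary using (Dec; yes; does; map′; _×-dec_; _→-dec_)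
open import Relation.Nullary.Decidable using (toWitness)
open import Relation.Unary using (Decidable)

-- Sums over the cube

∑ᵛ : ∀ n → (Vertex n → ℤ) → ℤ
∑ᵛ zero    f = f []
∑ᵛ (suc n) f = ∑ᵛ n (f ∘ (true ∷_)) + ∑ᵛ n (f ∘ (false ∷_))

∑ᵛ-cong : ∀ n {f g : Vertex n → ℤ} → f ≗ g → ∑ᵛ n f ≡ ∑ᵛ n g
∑ᵛ-cong zero    f≗g = f≗g []
∑ᵛ-cong (suc n) f≗g = cong₂ _+_ (∑ᵛ-cong n (f≗g ∘ (true ∷_))) (∑ᵛ-cong n (f≗g ∘ (false ∷_)))

∑ᵛ-zero : ∀ n → ∑ᵛ n (λ _ → 0ℤ) ≡ 0ℤ
∑ᵛ-zero zero    = refl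
∑ᵛ-zero (suc n) = cong₂ _+_ (∑ᵛ-zero n) (∑ᵛ-zero n)

∑ᵛ-distrib-+ : ∀ n (f g : Vertex n → ℤ) → ∑ᵛ n (λ x → f x + g x) ≡ ∑ᵛ n f + ∑ᵛ n g
∑ᵛ-distrib-+ zero    f g = refl
∑ᵛ-distrib-+ (suc n) f g =
  trans (cong₂ _+_ (∑ᵛ-distrib-+ n f₁ g₁) (∑ᵛ-distrib-+ n f₀ g₀))
        (interchange (∑ᵛ n f₁) (∑ᵛ n g₁) (∑ᵛ n f₀) (∑ᵛ n g₀))
  where
  f₁ f₀ g₁ g₀ : Vertex n → ℤ
  f₁ = f ∘ (true ∷_)
  f₀ = f ∘ (false ∷_)
  g₁ = g ∘ (true ∷_)
  g₀ = g ∘ (false ∷_)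

∑ᵛ-*ˡ : ∀ n c (f : Vertex n → ℤ) → ∑ᵛ n (λ x → c * f x) ≡ c * ∑ᵛ n f
∑ᵛ-*ˡ zero    c f = refl
∑ᵛ-*ˡ (suc n) c f = trans (cong₂ _+_ (∑ᵛ-*ˡ n c _) (∑ᵛ-*ˡ n c _)) (sym (ℤ.*-distribˡ-+ c _ _))

∑ᵛ-*ʳ : ∀ n c (f : Vertex n → ℤ) → ∑ᵛ n (λ x → f x * c) ≡ ∑ᵛ n f * c
∑ᵛ-*ʳ n c f = trans (∑ᵛ-cong n (λ x → ℤ.*-comm (f x) c)) (trans (∑ᵛ-*ˡ n c f) (ℤ.*-comm c _))

∑ᵛ-comm : ∀ m n (h : Vertex m → Vertex n → ℤ) →
          ∑ᵛ m (λ x → ∑ᵛ n (h x)) ≡ ∑ᵛ n (λ y → ∑ᵛ m (λ x → h x y))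
∑ᵛ-comm zero    n h = refl
∑ᵛ-comm (suc m) n h = trans (cong₂ _+_ (∑ᵛ-comm m n _) (∑ᵛ-comm m n _)) (sym (∑ᵛ-distrib-+ n _ _))

∑ᵛ-product : ∀ n (f g : Vertex n → ℤ) → ∑ᵛ n f * ∑ᵛ n g ≡ ∑ᵛ n λ x → ∑ᵛ n λ y → f x * g y
∑ᵛ-product n f g =
  trans (sym (∑ᵛ-*ʳ n (∑ᵛ n g) f)) (∑ᵛ-cong n λ x → sym (∑ᵛ-*ˡ n (f x) g))

∑ᵛ-mono-≤ : ∀ n {f g : Vertex n → ℤ} → (∀ x → f x ≤ g x) → ∑ᵛ n f ≤ ∑ᵛ n g
∑ᵛ-mono-≤ zero    f≤g = f≤g []
∑ᵛ-mono-≤ (suc n) f≤g = ℤ.+-mono-≤ (∑ᵛ-mono-≤ n (f≤g ∘ _)) (∑ᵛ-mono-≤ n (f≤g ∘ _))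

∑ᵛ-nonNeg : ∀ n {f : Vertex n → ℤ} → (∀ x → 0ℤ ≤ f x) → 0ℤ ≤ ∑ᵛ n f
∑ᵛ-nonNeg n {f} 0≤f = subst (_≤ ∑ᵛ n f) (∑ᵛ-zero n) (∑ᵛ-mono-≤ n 0≤f)

∑ᵛ-nonPos : ∀ n {f : Vertex n → ℤ} → (∀ x → f x ≤ 0ℤ) → ∑ᵛ n f ≤ 0ℤ
∑ᵛ-nonPos n {f} f≤0 = subst (∑ᵛ n f ≤_) (∑ᵛ-zero n) (∑ᵛ-mono-≤ n f≤0)

term≤∑ᵛ : ∀ n {f : Vertex n → ℤ} → (∀ x → 0ℤ ≤ f x) → ∀ w → f w ≤ ∑ᵛ n f
term≤∑ᵛ zero    0≤f [] = ℤ.≤-refl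
term≤∑ᵛ (suc n) 0≤f (true ∷ w) =
  ℤ.≤-trans (term≤∑ᵛ n (0≤f ∘ _) w) (ℤ.i≤i+j _ _ {{nonNegative (∑ᵛ-nonNeg n (0≤f ∘ _))}})
term≤∑ᵛ (suc n) 0≤f (false ∷ w) =
  ℤ.≤-trans (term≤∑ᵛ n (0≤f ∘ _) w) (ℤ.i≤j+i _ _ {{nonNegative (∑ᵛ-nonNeg n (0≤f ∘ _))}})

∑ᵛ≤term : ∀ n {f : Vertex n → ℤ} w → (∀ x → x ≢ w → f x ≤ 0ℤ) → ∑ᵛ n f ≤ f w
∑ᵛ≤term zero    [] _ = ℤ.≤-refl
∑ᵛ≤term (suc n) (true ∷ w) f≤0 = subst (_ ≤_) (ℤ.+-identityʳ _) (ℤ.+-mono-≤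
  (∑ᵛ≤term n w λ x x≢w → f≤0 (true ∷ x) (x≢w ∘ ∷-injectiveʳ))
  (∑ᵛ-nonPos n λ x → f≤0 (false ∷ x) λ ()))
∑ᵛ≤term (suc n) (false ∷ w) f≤0 = subst (_ ≤_) (ℤ.+-identityˡ _) (ℤ.+-mono-≤
  (∑ᵛ-nonPos n λ x → f≤0 (true ∷ x) λ ())
  (∑ᵛ≤term n w λ x x≢w → f≤0 (false ∷ x) (x≢w ∘ ∷-injectiveʳ)))

0≤i*i : ∀ i → 0ℤ ≤ i * i
0≤i*i (+ m)    = subst (0ℤ ≤_) (ℤ.pos-* m m) (+≤+ z≤n)
0≤i*i -[1+ m ] = +≤+ z≤n

0≤i*j : ∀ {i j} → 0ℤ ≤ i → 0ℤ ≤ j → 0ℤ ≤ i * j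
0≤i*j {+ m} {+ n} _ _ = subst (0ℤ ≤_) (ℤ.pos-* m n) (+≤+ z≤n)

-- Characters and Hamming distance

_⊕_ : ∀ {n} → Vertex n → Vertex n → Vertex n
_⊕_ = zipWith _xor_

0ᵛ : ∀ {n} → Vertex n
0ᵛ = replicate _ false

weight : ∀ {n} → Vertex n → ℕ
weight []          = 0
weight (true ∷ x)  = suc (weight x)
weight (false ∷ x) = weight x

weight-0ᵛ : ∀ n → weight (0ᵛ {n}) ≡ 0
weight-0ᵛ zero    = refl
weight-0ᵛ (suc n) = weight-0ᵛ n

⊕-self : ∀ {n} (x : Vertex n) → x ⊕ x ≡ 0ᵛ
⊕-self []      = refl
⊕-self (b ∷ x) = cong₂ _∷_ (xor-same b) (⊕-self x)

hamming≡weight-⊕ : ∀ {n} (x y : Vertex n) → hamming x y ≡ weight (x ⊕ y)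
hamming≡weight-⊕ []          []          = refl
hamming≡weight-⊕ (true ∷ x)  (true ∷ y)  = hamming≡weight-⊕ x y
hamming≡weight-⊕ (true ∷ x)  (false ∷ y) = cong suc (hamming≡weight-⊕ x y)
hamming≡weight-⊕ (false ∷ x) (true ∷ y)  = cong suc (hamming≡weight-⊕ x y)
hamming≡weight-⊕ (false ∷ x) (false ∷ y) = hamming≡weight-⊕ x y

-- χ z x = (-1)^(z · x)
χ : ∀ {n} → Vertex n → Vertex n → ℤ
χ []          []          = 1ℤ
χ (true ∷ z)  (true ∷ x)  = - χ z x
χ (true ∷ z)  (false ∷ x) = χ z x
χ (false ∷ z) (_ ∷ x)     = χ z x

χ-⊕ : ∀ {n} (z x y : Vertex n) → χ z x * χ z y ≡ χ z (x ⊕ y)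
χ-⊕ []          []          []          = refl
χ-⊕ (false ∷ z) (_ ∷ x)     (_ ∷ y)     = χ-⊕ z x y
χ-⊕ (true ∷ z)  (false ∷ x) (false ∷ y) = χ-⊕ z x y
χ-⊕ (true ∷ z)  (true ∷ x)  (true ∷ y)  = trans (neg*neg (χ z x) (χ z y)) (χ-⊕ z x y)
  where
  neg*neg : ∀ a b → (- a) * (- b) ≡ a * b
  neg*neg = solve-∀
χ-⊕ (true ∷ z)  (true ∷ x)  (false ∷ y) =
  trans (sym (ℤ.neg-distribˡ-* (χ z x) (χ z y))) (cong -_ (χ-⊕ z x y))
χ-⊕ (true ∷ z)  (false ∷ x) (true ∷ y)  =
  trans (sym (ℤ.neg-distribʳ-* (χ z x) (χ z y))) (cong -_ (χ-⊕ z x y))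

χ-0ᵛ : ∀ {n} (x : Vertex n) → χ 0ᵛ x ≡ 1ℤ
χ-0ᵛ []      = refl
χ-0ᵛ (_ ∷ x) = χ-0ᵛ x

hamming-self : ∀ {n} (x : Vertex n) → hamming x x ≡ 0
hamming-self []          = refl
hamming-self (true ∷ x)  = hamming-self x
hamming-self (false ∷ x) = hamming-self x

hamming-∷ : ∀ {n} b (x y : Vertex n) → hamming (b ∷ x) (b ∷ y) ≡ hamming x y
hamming-∷ true  x y = refl
hamming-∷ false x y = refl

hamming-triangle : ∀ {n} (u v w : Vertex n) → hamming u w ℕ.≤ hamming u v ℕ.+ hamming v w
hamming-triangle [] [] [] = z≤n
hamming-triangle (true ∷ u)  (true ∷ v)  (true ∷ w)  = hamming-triangle u v w
hamming-triangle (false ∷ u) (false ∷ v) (false ∷ w) = hamming-triangle u v w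
hamming-triangle (true ∷ u)  (false ∷ v) (false ∷ w) = s≤s (hamming-triangle u v w)
hamming-triangle (false ∷ u) (true ∷ v)  (true ∷ w)  = s≤s (hamming-triangle u v w)
hamming-triangle (true ∷ u)  (true ∷ v)  (false ∷ w) =
  subst (suc (hamming u w) ℕ.≤_) (sym (ℕ.+-suc _ _)) (s≤s (hamming-triangle u v w))
hamming-triangle (false ∷ u) (false ∷ v) (true ∷ w)  =
  subst (suc (hamming u w) ℕ.≤_) (sym (ℕ.+-suc _ _)) (s≤s (hamming-triangle u v w))
hamming-triangle (true ∷ u)  (false ∷ v) (true ∷ w)  =
  ℕ.≤-trans (hamming-triangle u v w) (ℕ.+-mono-≤ (ℕ.n≤1+n _) (ℕ.n≤1+n _))
hamming-triangle (false ∷ u) (true ∷ v)  (false ∷ w) =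
  ℕ.≤-trans (hamming-triangle u v w) (ℕ.+-mono-≤ (ℕ.n≤1+n _) (ℕ.n≤1+n _))

walk⇒hamming≤ : ∀ {n l} {u v : Vertex n} → Walk l u v → hamming u v ℕ.≤ l
walk⇒hamming≤ {u = u} here = ℕ.≤-reflexive (hamming-self u)
walk⇒hamming≤ {u = u} (step {v = v} {w = w} u~v walk) =
  ℕ.≤-trans (hamming-triangle u v w)
            (subst (λ k → k ℕ.+ hamming v w ℕ.≤ suc _) (sym u~v) (s≤s (walk⇒hamming≤ walk)))

∷-walk : ∀ {n l} b {u v : Vertex n} → Walk l u v → Walk l (b ∷ u) (b ∷ v)
∷-walk b here           = here
∷-walk b (step u~v walk) = step (trans (hamming-∷ b _ _) u~v) (∷-walk b walk)

hamming-walk : ∀ {n} (u v : Vertex n) → Walk (hamming u v) u v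
hamming-walk []          []          = here
hamming-walk (true ∷ u)  (true ∷ v)  = ∷-walk true (hamming-walk u v)
hamming-walk (false ∷ u) (false ∷ v) = ∷-walk false (hamming-walk u v)
hamming-walk (true ∷ u)  (false ∷ v) =
  step (cong suc (hamming-self u)) (∷-walk false (hamming-walk u v))
hamming-walk (false ∷ u) (true ∷ v)  =
  step (cong suc (hamming-self u)) (∷-walk true (hamming-walk u v))

DistLe⇒hamming≤ : ∀ {n k} {u v : Vertex n} → DistLe k u v → hamming u v ℕ.≤ k
DistLe⇒hamming≤ (l , l≤k , walk) = ℕ.≤-trans (walk⇒hamming≤ walk) l≤k

hamming≤⇒DistLe : ∀ {n k} {u v : Vertex n} → hamming u v ℕ.≤ k → DistLe k u v
hamming≤⇒DistLe {u = u} {v} h≤k = hamming u v , h≤k , hamming-walk u v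

-- Delsarte's linear programming bound

𝟙 : Bool → ℤ
𝟙 true  = 1ℤ
𝟙 false = 0ℤ

𝟙-idem : ∀ b → 𝟙 b * 𝟙 b ≡ 𝟙 b
𝟙-idem true  = refl
𝟙-idem false = refl

𝟙-nonNeg : ∀ b → 0ℤ ≤ 𝟙 b
𝟙-nonNeg true  = +≤+ z≤n
𝟙-nonNeg false = +≤+ z≤n

size : ∀ {n} → (Vertex n → Bool) → ℤ
size {n} C = ∑ᵛ n (𝟙 ∘ C)

MinDistance : ∀ {n} → ℕ → (Vertex n → Bool) → Set
MinDistance d C = ∀ {x y} → T (C x) → T (C y) → x ≢ y → d ℕ.≤ hamming x y

module Delsarte {n : ℕ} (β : ℕ → ℕ) where

  Φ : Vertex n → ℤ
  Φ x = ∑ᵛ n λ z → + β (weight z) * χ z x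

  fourier : (Vertex n → ℤ) → Vertex n → ℤ
  fourier g z = ∑ᵛ n λ x → g x * χ z x

  fourier-0ᵛ : ∀ g → fourier g 0ᵛ ≡ ∑ᵛ n g
  fourier-0ᵛ g = ∑ᵛ-cong n λ x → trans (cong (g x *_) (χ-0ᵛ x)) (ℤ.*-identityʳ (g x))

  weighted-plancherel : ∀ g → ∑ᵛ n (λ z → + β (weight z) * (fourier g z * fourier g z))
                            ≡ ∑ᵛ n λ x → ∑ᵛ n λ y → g x * g y * Φ (x ⊕ y)
  weighted-plancherel g = begin
    ∑ᵛ n (λ z → b z * (ĝ z * ĝ z))                   ≡⟨ ∑ᵛ-cong n expand ⟩
    ∑ᵛ n (λ z → ∑ᵛ n λ x → ∑ᵛ n λ y → term z x y)   ≡⟨ ∑ᵛ-comm n n _ ⟩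
    ∑ᵛ n (λ x → ∑ᵛ n λ z → ∑ᵛ n λ y → term z x y)   ≡⟨ ∑ᵛ-cong n (λ x → ∑ᵛ-comm n n _) ⟩
    ∑ᵛ n (λ x → ∑ᵛ n λ y → ∑ᵛ n λ z → term z x y)   ≡⟨ ∑ᵛ-cong n (λ x → ∑ᵛ-cong n (collect x)) ⟩
    ∑ᵛ n (λ x → ∑ᵛ n λ y → g x * g y * Φ (x ⊕ y))   ∎
    where
    open ≡-Reasoning
    b : Vertex n → ℤ
    b z = + β (weight z)
    ĝ : Vertex n → ℤ
    ĝ = fourier g
    term : Vertex n → Vertex n → Vertex n → ℤ
    term z x y = b z * ((g x * χ z x) * (g y * χ z y))

    expand : ∀ z → b z * (ĝ z * ĝ z) ≡ ∑ᵛ n λ x → ∑ᵛ n λ y → term z x y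
    expand z = begin
      b z * (ĝ z * ĝ z)
        ≡⟨ cong (b z *_) (∑ᵛ-product n _ _) ⟩
      b z * ∑ᵛ n (λ x → ∑ᵛ n λ y → (g x * χ z x) * (g y * χ z y))
        ≡⟨ sym (∑ᵛ-*ˡ n (b z) _) ⟩
      ∑ᵛ n (λ x → b z * ∑ᵛ n λ y → (g x * χ z x) * (g y * χ z y))
        ≡⟨ ∑ᵛ-cong n (λ x → sym (∑ᵛ-*ˡ n (b z) _)) ⟩
      ∑ᵛ n (λ x → ∑ᵛ n λ y → term z x y)
        ∎

    rearrange : ∀ a p q r s → a * ((p * q) * (r * s)) ≡ p * r * (a * (q * s))
    rearrange = solve-∀

    collect : ∀ x y → ∑ᵛ n (λ z → term z x y) ≡ g x * g y * Φ (x ⊕ y)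
    collect x y = begin
      ∑ᵛ n (λ z → term z x y)
        ≡⟨ ∑ᵛ-cong n (λ z → rearrange (b z) (g x) (χ z x) (g y) (χ z y)) ⟩
      ∑ᵛ n (λ z → g x * g y * (b z * (χ z x * χ z y)))
        ≡⟨ ∑ᵛ-cong n (λ z → cong (λ c → g x * g y * (b z * c)) (χ-⊕ z x y)) ⟩
      ∑ᵛ n (λ z → g x * g y * (b z * χ z (x ⊕ y)))
        ≡⟨ ∑ᵛ-*ˡ n (g x * g y) _ ⟩
      g x * g y * Φ (x ⊕ y)
        ∎

  delsarte-bound : ∀ {d} (C : Vertex n → Bool) → MinDistance d C →
                   (∀ x → d ℕ.≤ weight x → Φ x ≤ 0ℤ) →
                   + β 0 * (size C * size C) ≤ Φ 0ᵛ * size C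
  delsarte-bound {d} C dist Φ≤0 = begin
    + β 0 * (size C * size C)
      ≡⟨ cong₂ (λ k s → + β k * (s * s)) (sym (weight-0ᵛ n)) (sym (fourier-0ᵛ g)) ⟩
    + β (weight (0ᵛ {n})) * (ĝ 0ᵛ * ĝ 0ᵛ)
      ≤⟨ term≤∑ᵛ n (λ z → 0≤i*j {+ β (weight z)} (+≤+ z≤n) (0≤i*i (ĝ z))) 0ᵛ ⟩
    ∑ᵛ n (λ z → + β (weight z) * (ĝ z * ĝ z))
      ≡⟨ weighted-plancherel g ⟩
    ∑ᵛ n (λ x → ∑ᵛ n λ y → g x * g y * Φ (x ⊕ y))
      ≤⟨ ∑ᵛ-mono-≤ n (λ x → ∑ᵛ≤term n x (off-diagonal x)) ⟩
    ∑ᵛ n (λ x → g x * g x * Φ (x ⊕ x))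
      ≡⟨ ∑ᵛ-cong n diagonal ⟩
    ∑ᵛ n (λ x → g x * Φ 0ᵛ)
      ≡⟨ ∑ᵛ-*ʳ n _ g ⟩
    size C * Φ 0ᵛ
      ≡⟨ ℤ.*-comm (size C) _ ⟩
    Φ 0ᵛ * size C
      ∎
    where
    open ≤-Reasoning
    g : Vertex n → ℤ
    g = 𝟙 ∘ C
    ĝ : Vertex n → ℤ
    ĝ = fourier g

    off-diagonal : ∀ x y → y ≢ x → g x * g y * Φ (x ⊕ y) ≤ 0ℤ
    off-diagonal x y y≢x with C x in Cx | C y in Cy
    ... | false | _     = +≤+ z≤n
    ... | true  | false = +≤+ z≤n
    ... | true  | true  = subst (_≤ 0ℤ) (sym (ℤ.*-identityˡ _)) (Φ≤0 (x ⊕ y) d≤weight)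
      where
      d≤weight : d ℕ.≤ weight (x ⊕ y)
      d≤weight = subst (d ℕ.≤_) (hamming≡weight-⊕ x y)
                   (dist (subst T (sym Cx) _) (subst T (sym Cy) _) (y≢x ∘ sym))

    diagonal : ∀ x → g x * g x * Φ (x ⊕ x) ≡ g x * Φ 0ᵛ
    diagonal x = cong₂ _*_ (𝟙-idem (C x)) (cong Φ (⊕-self x))

witness-of-does : ∀ {A : Set} (a? : Dec A) → T (does a?) → A
witness-of-does (yes a) _ = a

fibre : ∀ {n c} → (Vertex n → Fin c) → Fin c → Vertex n → Bool
fibre f i x = does (f x Fin.≟ i)

fibre-minDistance : ∀ {n k c} {f : Vertex n → Fin c} → ProperColoring n k c f →
                    ∀ i → MinDistance (suc k) (fibre f i)
fibre-minDistance {f = f} proper i {x} {y} x∈fibre y∈fibre x≢y =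
  ℕ.≰⇒> λ hamming≤k → proper x y (x≢y , hamming≤⇒DistLe hamming≤k) (trans fx≡i (sym fy≡i))
  where
  fx≡i = witness-of-does (f x Fin.≟ i) x∈fibre
  fy≡i = witness-of-does (f y Fin.≟ i) y∈fibre

∑ᵛ-∑ : ∀ n c (h : Fin c → Vertex n → ℤ) → ∑ᵛ n (λ x → ∑[ i < c ] h i x) ≡ ∑[ i < c ] ∑ᵛ n (h i)
∑ᵛ-∑ n zero    h = ∑ᵛ-zero n
∑ᵛ-∑ n (suc c) h =
  trans (∑ᵛ-distrib-+ n _ _) (cong (_+_ (∑ᵛ n (h Fin.zero))) (∑ᵛ-∑ n c (h ∘ Fin.suc)))

∑-𝟙-≟ : ∀ {c} (j : Fin c) → ∑[ i < c ] 𝟙 (does (j Fin.≟ i)) ≡ 1ℤ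
∑-𝟙-≟ {suc c} Fin.zero    = cong (_+_ 1ℤ) (sum-replicate-zero c)
∑-𝟙-≟ {suc c} (Fin.suc j) = trans (ℤ.+-identityˡ _) (∑-𝟙-≟ j)

sum-≤ : ∀ {c m} (h : Fin c → ℤ) → (∀ i → h i ≤ + m) → ∑[ i < c ] h i ≤ + (c ℕ.* m)
sum-≤ {zero}      h h≤m = +≤+ z≤n
sum-≤ {suc c} {m} h h≤m =
  ℤ.≤-trans (ℤ.+-mono-≤ (h≤m Fin.zero) (sum-≤ (h ∘ Fin.suc) (h≤m ∘ Fin.suc)))
            (ℤ.≤-reflexive (sym (ℤ.pos-+ m (c ℕ.* m))))

pigeonhole : ∀ {n c m} (f : Vertex n → Fin c) → (∀ i → size (fibre f i) ≤ + m) →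
             ∑ᵛ n (λ _ → 1ℤ) ≤ + (c ℕ.* m)
pigeonhole {n} {c} {m} f small = begin
  ∑ᵛ n (λ _ → 1ℤ)                          ≡⟨ ∑ᵛ-cong n (sym ∘ ∑-𝟙-≟ ∘ f) ⟩
  ∑ᵛ n (λ x → ∑[ i < c ] 𝟙 (fibre f i x))  ≡⟨ ∑ᵛ-∑ n c _ ⟩
  ∑[ i < c ] size (fibre f i)              ≤⟨ sum-≤ _ small ⟩
  + (c ℕ.* m)                              ∎
  where open ≤-Reasoning

all-vertices? : ∀ {n} {P : Vertex n → Set} → Decidable P → Dec (∀ u → P u)
all-vertices? {zero}  P? = map′ (λ { p [] → p }) (_$ []) (P? [])
all-vertices? {suc n} P? =
  map′ (λ { (p , q) (true ∷ u) → p u ; (p , q) (false ∷ u) → q u })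
       (λ p → p ∘ (true ∷_) , p ∘ (false ∷_))
       (all-vertices? (P? ∘ (true ∷_)) ×-dec all-vertices? (P? ∘ (false ∷_)))

-- A dual solution of Delsarte's linear programme for binary codes of length 9 and
-- minimum distance 3: Φ is 256, 64, 64 and -64 on words of weight 0, 1, 2 and 9, and 0 otherwise.
lpWeights : ℕ → ℕ
lpWeights 0 = 6
lpWeights 1 = 4
lpWeights 2 = 2
lpWeights 3 = 1
lpWeights 7 = 1
lpWeights 8 = 2
lpWeights 9 = 4
lpWeights _ = 0

open Delsarte {9} lpWeights using (Φ; delsarte-bound)

Φ-0ᵛ : Φ 0ᵛ ≡ + 256
Φ-0ᵛ = refl

Φ-nonPos : ∀ x → 3 ℕ.≤ weight x → Φ x ≤ 0ℤ
Φ-nonPos = toWitness {a? = all-vertices? λ x → 3 ℕ.≤? weight x →-dec Φ x ℤ.≤? 0ℤ} _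

6N²≤256N⇒N≤42 : ∀ N → 0ℤ ≤ N → + 6 * (N * N) ≤ + 256 * N → N ≤ + 42
6N²≤256N⇒N≤42 (+ zero)   _ _  = +≤+ z≤n
6N²≤256N⇒N≤42 +[1+ k ] _ le =
  +≤+ (ℕ.s≤s⁻¹ (ℕ.*-cancelˡ-< 6 m 43 (ℕ.≤-<-trans 6m≤256 (ℕ.m<m+n 256 {2} z<s))))
  where
  m = suc k
  6m≤256 : 6 ℕ.* m ℕ.≤ 256
  6m≤256 = ℕ.*-cancelʳ-≤ (6 ℕ.* m) 256 m
             (subst (ℕ._≤ 256 ℕ.* m) (sym (ℕ.*-assoc 6 m m)) (ℤ.drop‿+≤+ le))

code-size≤42 : (C : Vertex 9 → Bool) → MinDistance 3 C → size C ≤ + 42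
code-size≤42 C dist = 6N²≤256N⇒N≤42 (size C) (∑ᵛ-nonNeg 9 (𝟙-nonNeg ∘ C))
  (subst (λ a → + 6 * (size C * size C) ≤ a * size C) Φ-0ᵛ (delsarte-bound C dist Φ-nonPos))

colorable⇒13≤ : ∀ c → Colorable 9 2 c → 13 ℕ.≤ c
colorable⇒13≤ c (f , proper) =
  ℕ.*-cancelʳ-< 42 12 c (ℕ.<-≤-trans (ℕ.m<m+n 504 {8} z<s) 512≤c*42)
  where
  512≤c*42 : 512 ℕ.≤ c ℕ.* 42
  512≤c*42 = ℤ.drop‿+≤+ (pigeonhole f λ i → code-size≤42 (fibre f i) (fibre-minDistance proper i))

-- An explicit 14-colouring

ball : ∀ {n} → ℕ → Vertex n → List (Vertex n)
ball k       []      = [] ∷ []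
ball zero    (b ∷ u) = map (b ∷_) (ball zero u)
ball (suc k) (b ∷ u) = map (b ∷_) (ball (suc k) u) ++ map (not b ∷_) (ball k u)

∷-∈-ball : ∀ {n} k b (u : Vertex n) {v} → v ∈ ball k u → b ∷ v ∈ ball k (b ∷ u)
∷-∈-ball zero    b u v∈ball = ∈-map⁺ (b ∷_) v∈ball
∷-∈-ball (suc k) b u v∈ball = ∈-++⁺ˡ (∈-map⁺ (b ∷_) v∈ball)

hamming≤⇒∈-ball : ∀ {n} k (u v : Vertex n) → hamming u v ℕ.≤ k → v ∈ ball k u
hamming≤⇒∈-ball k       []          []          _   = here refl
hamming≤⇒∈-ball k       (true ∷ u)  (true ∷ v)  h≤k = ∷-∈-ball k true u (hamming≤⇒∈-ball k u v h≤k)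
hamming≤⇒∈-ball k       (false ∷ u) (false ∷ v) h≤k = ∷-∈-ball k false u (hamming≤⇒∈-ball k u v h≤k)
hamming≤⇒∈-ball (suc k) (true ∷ u)  (false ∷ v) (s≤s h≤k) =
  ∈-++⁺ʳ _ (∈-map⁺ (false ∷_) (hamming≤⇒∈-ball k u v h≤k))
hamming≤⇒∈-ball (suc k) (false ∷ u) (true ∷ v)  (s≤s h≤k) =
  ∈-++⁺ʳ _ (∈-map⁺ (true ∷_) (hamming≤⇒∈-ball k u v h≤k))

properColoring-by-balls : ∀ {n k c} (f : Vertex n → Fin c) →
                          (∀ u → All (λ v → f u ≡ f v → u ≡ v) (ball k u)) →
                          ProperColoring n k c f
properColoring-by-balls {k = k} f injective-on-balls u v (u≢v , dist) fu≡fv =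
  u≢v (All.lookup (injective-on-balls u) v∈ball fu≡fv)
  where
  v∈ball = hamming≤⇒∈-ball k u v (DistLe⇒hamming≤ dist)

lookupᵇ : ∀ {n} {A : Set} → Vec A (2 ^ n) → Vertex n → A
lookupᵇ         (x ∷ []) []          = x
lookupᵇ {suc n} xs       (false ∷ v) = lookupᵇ (take (2 ^ n) xs) v
lookupᵇ {suc n} xs       (true ∷ v)  = lookupᵇ (take (2 ^ n) (drop (2 ^ n) xs)) v

colourTable : Vec (Vec (Fin 14) 16) 32
colourTable =
  (# 9 ∷ # 0 ∷ # 5 ∷ # 3 ∷ # 1 ∷ # 6 ∷ # 8 ∷ # 13 ∷ # 4 ∷ # 8 ∷ # 0 ∷ # 11 ∷ # 10 ∷ # 12 ∷ # 3 ∷ # 7 ∷ []) ∷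
  (# 10 ∷ # 7 ∷ # 1 ∷ # 12 ∷ # 13 ∷ # 2 ∷ # 7 ∷ # 11 ∷ # 2 ∷ # 1 ∷ # 9 ∷ # 5 ∷ # 6 ∷ # 4 ∷ # 12 ∷ # 0 ∷ []) ∷
  (# 6 ∷ # 11 ∷ # 12 ∷ # 4 ∷ # 2 ∷ # 8 ∷ # 11 ∷ # 1 ∷ # 3 ∷ # 5 ∷ # 10 ∷ # 2 ∷ # 7 ∷ # 0 ∷ # 13 ∷ # 9 ∷ []) ∷
  (# 5 ∷ # 3 ∷ # 2 ∷ # 10 ∷ # 9 ∷ # 12 ∷ # 0 ∷ # 6 ∷ # 11 ∷ # 13 ∷ # 4 ∷ # 7 ∷ # 1 ∷ # 10 ∷ # 8 ∷ # 3 ∷ []) ∷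
  (# 11 ∷ # 5 ∷ # 2 ∷ # 10 ∷ # 12 ∷ # 9 ∷ # 6 ∷ # 0 ∷ # 7 ∷ # 3 ∷ # 12 ∷ # 4 ∷ # 2 ∷ # 1 ∷ # 11 ∷ # 8 ∷ []) ∷
  (# 3 ∷ # 13 ∷ # 4 ∷ # 6 ∷ # 0 ∷ # 10 ∷ # 9 ∷ # 3 ∷ # 5 ∷ # 11 ∷ # 10 ∷ # 2 ∷ # 8 ∷ # 7 ∷ # 1 ∷ # 13 ∷ []) ∷
  (# 1 ∷ # 2 ∷ # 7 ∷ # 9 ∷ # 10 ∷ # 7 ∷ # 3 ∷ # 12 ∷ # 9 ∷ # 10 ∷ # 5 ∷ # 1 ∷ # 4 ∷ # 13 ∷ # 0 ∷ # 6 ∷ []) ∷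
  (# 8 ∷ # 4 ∷ # 11 ∷ # 0 ∷ # 6 ∷ # 1 ∷ # 13 ∷ # 8 ∷ # 0 ∷ # 6 ∷ # 3 ∷ # 12 ∷ # 12 ∷ # 2 ∷ # 7 ∷ # 11 ∷ []) ∷
  (# 2 ∷ # 13 ∷ # 11 ∷ # 7 ∷ # 5 ∷ # 10 ∷ # 0 ∷ # 9 ∷ # 1 ∷ # 6 ∷ # 8 ∷ # 12 ∷ # 9 ∷ # 2 ∷ # 4 ∷ # 1 ∷ []) ∷
  (# 12 ∷ # 5 ∷ # 6 ∷ # 0 ∷ # 8 ∷ # 1 ∷ # 3 ∷ # 4 ∷ # 7 ∷ # 10 ∷ # 13 ∷ # 3 ∷ # 0 ∷ # 13 ∷ # 11 ∷ # 6 ∷ []) ∷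
  (# 10 ∷ # 1 ∷ # 3 ∷ # 8 ∷ # 13 ∷ # 3 ∷ # 6 ∷ # 5 ∷ # 12 ∷ # 9 ∷ # 7 ∷ # 0 ∷ # 11 ∷ # 4 ∷ # 2 ∷ # 10 ∷ []) ∷
  (# 0 ∷ # 6 ∷ # 9 ∷ # 13 ∷ # 4 ∷ # 11 ∷ # 10 ∷ # 2 ∷ # 8 ∷ # 2 ∷ # 1 ∷ # 11 ∷ # 3 ∷ # 7 ∷ # 5 ∷ # 12 ∷ []) ∷
  (# 6 ∷ # 8 ∷ # 13 ∷ # 1 ∷ # 3 ∷ # 4 ∷ # 10 ∷ # 2 ∷ # 10 ∷ # 0 ∷ # 3 ∷ # 9 ∷ # 13 ∷ # 11 ∷ # 7 ∷ # 5 ∷ []) ∷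
  (# 1 ∷ # 2 ∷ # 8 ∷ # 11 ∷ # 11 ∷ # 6 ∷ # 5 ∷ # 12 ∷ # 9 ∷ # 12 ∷ # 0 ∷ # 7 ∷ # 4 ∷ # 3 ∷ # 2 ∷ # 10 ∷ []) ∷
  (# 5 ∷ # 12 ∷ # 0 ∷ # 6 ∷ # 9 ∷ # 0 ∷ # 4 ∷ # 11 ∷ # 2 ∷ # 7 ∷ # 11 ∷ # 13 ∷ # 1 ∷ # 8 ∷ # 12 ∷ # 3 ∷ []) ∷
  (# 7 ∷ # 10 ∷ # 12 ∷ # 3 ∷ # 2 ∷ # 13 ∷ # 1 ∷ # 7 ∷ # 13 ∷ # 1 ∷ # 6 ∷ # 4 ∷ # 10 ∷ # 5 ∷ # 9 ∷ # 0 ∷ []) ∷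
  (# 8 ∷ # 1 ∷ # 4 ∷ # 2 ∷ # 0 ∷ # 7 ∷ # 9 ∷ # 12 ∷ # 5 ∷ # 9 ∷ # 1 ∷ # 10 ∷ # 11 ∷ # 13 ∷ # 2 ∷ # 6 ∷ []) ∷
  (# 11 ∷ # 6 ∷ # 0 ∷ # 13 ∷ # 12 ∷ # 3 ∷ # 6 ∷ # 10 ∷ # 3 ∷ # 0 ∷ # 8 ∷ # 4 ∷ # 7 ∷ # 5 ∷ # 13 ∷ # 1 ∷ []) ∷
  (# 7 ∷ # 10 ∷ # 13 ∷ # 5 ∷ # 3 ∷ # 9 ∷ # 10 ∷ # 0 ∷ # 2 ∷ # 4 ∷ # 11 ∷ # 3 ∷ # 6 ∷ # 1 ∷ # 12 ∷ # 8 ∷ []) ∷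
  (# 4 ∷ # 2 ∷ # 3 ∷ # 11 ∷ # 8 ∷ # 13 ∷ # 1 ∷ # 7 ∷ # 10 ∷ # 12 ∷ # 5 ∷ # 6 ∷ # 0 ∷ # 11 ∷ # 9 ∷ # 2 ∷ []) ∷
  (# 10 ∷ # 4 ∷ # 3 ∷ # 11 ∷ # 13 ∷ # 8 ∷ # 7 ∷ # 1 ∷ # 6 ∷ # 2 ∷ # 13 ∷ # 5 ∷ # 3 ∷ # 0 ∷ # 10 ∷ # 9 ∷ []) ∷
  (# 2 ∷ # 12 ∷ # 5 ∷ # 7 ∷ # 1 ∷ # 11 ∷ # 8 ∷ # 2 ∷ # 4 ∷ # 10 ∷ # 11 ∷ # 3 ∷ # 9 ∷ # 6 ∷ # 0 ∷ # 12 ∷ []) ∷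
  (# 0 ∷ # 3 ∷ # 6 ∷ # 8 ∷ # 11 ∷ # 6 ∷ # 2 ∷ # 13 ∷ # 8 ∷ # 11 ∷ # 4 ∷ # 0 ∷ # 5 ∷ # 12 ∷ # 1 ∷ # 7 ∷ []) ∷
  (# 9 ∷ # 5 ∷ # 10 ∷ # 1 ∷ # 7 ∷ # 0 ∷ # 12 ∷ # 9 ∷ # 1 ∷ # 7 ∷ # 2 ∷ # 13 ∷ # 13 ∷ # 3 ∷ # 6 ∷ # 10 ∷ []) ∷
  (# 3 ∷ # 12 ∷ # 10 ∷ # 6 ∷ # 4 ∷ # 11 ∷ # 1 ∷ # 8 ∷ # 0 ∷ # 7 ∷ # 9 ∷ # 13 ∷ # 8 ∷ # 3 ∷ # 5 ∷ # 0 ∷ []) ∷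
  (# 13 ∷ # 4 ∷ # 7 ∷ # 1 ∷ # 9 ∷ # 0 ∷ # 2 ∷ # 5 ∷ # 6 ∷ # 11 ∷ # 12 ∷ # 2 ∷ # 1 ∷ # 12 ∷ # 10 ∷ # 7 ∷ []) ∷
  (# 11 ∷ # 0 ∷ # 2 ∷ # 9 ∷ # 12 ∷ # 2 ∷ # 7 ∷ # 4 ∷ # 13 ∷ # 8 ∷ # 6 ∷ # 1 ∷ # 10 ∷ # 5 ∷ # 3 ∷ # 11 ∷ []) ∷
  (# 1 ∷ # 7 ∷ # 8 ∷ # 12 ∷ # 5 ∷ # 10 ∷ # 11 ∷ # 3 ∷ # 9 ∷ # 3 ∷ # 0 ∷ # 10 ∷ # 2 ∷ # 6 ∷ # 4 ∷ # 13 ∷ []) ∷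
  (# 7 ∷ # 9 ∷ # 12 ∷ # 0 ∷ # 2 ∷ # 5 ∷ # 11 ∷ # 3 ∷ # 11 ∷ # 1 ∷ # 2 ∷ # 8 ∷ # 12 ∷ # 10 ∷ # 6 ∷ # 4 ∷ []) ∷
  (# 0 ∷ # 3 ∷ # 9 ∷ # 10 ∷ # 10 ∷ # 7 ∷ # 4 ∷ # 13 ∷ # 8 ∷ # 13 ∷ # 1 ∷ # 6 ∷ # 5 ∷ # 2 ∷ # 3 ∷ # 11 ∷ []) ∷
  (# 4 ∷ # 13 ∷ # 1 ∷ # 7 ∷ # 8 ∷ # 1 ∷ # 5 ∷ # 10 ∷ # 3 ∷ # 6 ∷ # 10 ∷ # 12 ∷ # 0 ∷ # 9 ∷ # 13 ∷ # 2 ∷ []) ∷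
  (# 6 ∷ # 11 ∷ # 13 ∷ # 2 ∷ # 3 ∷ # 12 ∷ # 0 ∷ # 6 ∷ # 12 ∷ # 0 ∷ # 7 ∷ # 5 ∷ # 11 ∷ # 4 ∷ # 8 ∷ # 1 ∷ []) ∷
  []

-- Rows are addressed by the first five bits and columns by the last four; the nesting keeps
-- lookups cheap when properness is decided by evaluation.
colouring : Vertex 9 → Fin 14
colouring v = lookupᵇ (lookupᵇ colourTable (take 5 v)) (drop 5 v)

colouring-injective-on-balls : ∀ u → All (λ v → colouring u ≡ colouring v → u ≡ v) (ball 2 u)
colouring-injective-on-balls = toWitness {a? = all-vertices? λ u →
  all? (λ v → colouring u Fin.≟ colouring v →-dec ≡-dec Bool._≟_ u v) (ball 2 u)} _

colorable-14 : Colorable 9 2 14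
colorable-14 = colouring , properColoring-by-balls colouring colouring-injective-on-balls

mainTheorem1 : Colorable 9 2 14 × (∀ (c : ℕ) → Colorable 9 2 c → 13 ℕ.≤ c)
mainTheorem1 = colorable-14 , colorable⇒13≤
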